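{- Let $\mathcal{S}$ be a single-set cubical $\omega$-category. For all $i,j\in\mathbb{N}_+$ and $\alpha\in\{ -,+\}$: (i) $\delta_{j+1}^\alpha s_jx=s_j\delta_j^\alpha x$ for all $x\in\mathcal{S}^j$; (ii) $s_i(x\circ_iy)=s_ix\circ_{i+1}s_iy$ for all $x,y\in\mathcal{S}^i$ with $\Delta_i(x,y)$; (iii) (Yang–Baxter) $s_is_{i+1}s_ix=s_{i+1}s_is_{i+1}x$ for all $x\in\mathcal{S}^{i,i+1}$.
   Context: A single-set category is a set $\mathcal{S}$ with $\delta^-,\delta^+:\mathcal{S}\to\mathcal{S}$ and $\odot:\mathcal{S}\times\mathcal{S}\to\mathcal{P}(\mathcal{S})$ (extended to subsets by unions) with $\{x\}\odot(y\odot z)=(x\odot y)\odot\{z\}$, $x\odot\delta^+x=\{x\}=\delta^-x\odot x$, $x\odot y\neq\varnothing\iff\delta^+x=\delta^-y$, and $|x\odot y|\leq1$; $\Delta(x,y)$ means $x\odot y\neq\varnothing$ and $x\circ y$ is its element. A single-set cubical $\omega$-category is a set $\mathcal{S}$ with, for each $i\in\mathbb{N}_+$, a single-set category structure $(\delta_i^\pm,\odot_i)$ (with $\Delta_i,\circ_i$) and maps $s_i,\tilde s_i:\mathcal{S}\to\mathcal{S}$; $\mathcal{S}^i$ is the set of fixed points of $\delta_i^-$ (equivalently $\delta_i^+$), $\mathcal{S}^{i,j}=\mathcal{S}^i\cap\mathcal{S}^j$. Axioms (all $i,j$, $\alpha,\beta$): $\delta_i^\alpha\delta_j^\beta=\delta_j^\beta\delta_i^\alpha$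 ($i\neq j$); $\delta_i^\alpha(x\circ_jy)=\delta_i^\alpha x\circ_j\delta_i^\alpha y$ ($i\neq j$, $\Delta_j(x,y)$); $(w\circ_ix)\circ_j(y\circ_iz)=(w\circ_jy)\circ_i(x\circ_jz)$ ($i\neq j$, $\Delta_i(w,x),\Delta_i(y,z),\Delta_j(w,y),\Delta_j(x,z)$); $s_i(\mathcal{S}^i)\subseteq\mathcal{S}^{i+1}$, $\tilde s_i(\mathcal{S}^{i+1})\subseteq\mathcal{S}^i$; $\tilde s_is_ix=x$ ($x\in\mathcal{S}^i$), $s_i\tilde s_iy=y$ ($y\in\mathcal{S}^{i+1}$); for $x\in\mathcal{S}^j$: $\delta_j^\alpha s_jx=s_j\delta_{j+1}^\alpha x$, $\delta_i^\alpha s_jx=s_j\delta_i^\alpha x$ ($i\neq j,j+1$); for $x,y\in\mathcal{S}^i$: $s_i(x\circ_{i+1}y)=s_ix\circ_is_iy$ ($\Delta_{i+1}(x,y)$), $s_i(x\circ_jy)=s_ix\circ_js_iy$ ($j\neq i,i+1$, $\Delta_j(x,y)$); $s_ix=x$ on $\mathcal{S}^{i,i+1}$; $s_is_jx=s_js_ix$ ($|i-j|\geq2$, $x\in\mathcal{S}^{i,j}$); every $x$ lies in $\mathcal{S}^i$ for all sufficiently large $i$. -}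

module Defs where

open import Data.Nat using (ℕ; suc; _≤_; _+_)
open import Data.Product using (Σ; ∃; _×_; _,_)
open import Relation.Binary.PropositionalEquality using (_≡_)
open import Relation.Nullary using (¬_)
open import Data.Sum using (_⊎_)

data Sign : Set where
  neg pos : Sign

-- A partial "multivalued" composition x ⊙ y ∈ P(S) is encoded as a relation
-- R x y w  meaning  w ∈ x ⊙ y.
Rel3 : Set → Set₁
Rel3 S = S → S → S → Set

record IsSingleSetCategory {S : Set} (δ⁻ δ⁺ : S → S) (R : Rel3 S) : Set where
  field
    assoc→ : ∀ x y z w → (∃ λ u → R y z u × R x u w) → (∃ λ v → R x y v × R v z w)
    assoc← : ∀ x y z w → (∃ λ v → R x y v × R v z w) → (∃ λ u → R y z u × R x u w)
    unitʳ→ : ∀ x w → R x (δ⁺ x) w → w ≡ x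
    unitʳ← : ∀ x → R x (δ⁺ x) x
    unitˡ→ : ∀ x w → R (δ⁻ x) x w → w ≡ x
    unitˡ← : ∀ x → R (δ⁻ x) x x
    defined→ : ∀ x y → (∃ λ w → R x y w) → δ⁺ x ≡ δ⁻ y
    defined← : ∀ x y → δ⁺ x ≡ δ⁻ y → ∃ λ w → R x y w
    functional : ∀ x y u v → R x y u → R x y v → u ≡ v

-- INDEXING CONVENTION: the paper's indices i ∈ ℕ₊ = {1,2,...} are represented by
-- k ∈ ℕ with paper index i = k + 1.  The shift is uniform (i+1 ↦ suc k), so all
-- axioms read literally the same.
record CubicalOmegaCat : Set₁ where
  field
    S    : Set
    δ    : ℕ → Sign → S → S
    Comp : ℕ → Rel3 S
    s    : ℕ → S → S
    s̃    : ℕ → S → S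
    isCat : ∀ i → IsSingleSetCategory (δ i neg) (δ i pos) (Comp i)

  Cell : ℕ → S → Set
  Cell i x = δ i neg x ≡ x

  Δ : ℕ → S → S → Set
  Δ i x y = ∃ λ w → Comp i x y w

  field
    δ-comm : ∀ i j α β x → ¬ i ≡ j → δ i α (δ j β x) ≡ δ j β (δ i α x)
    δ-comp : ∀ i j α x y w → ¬ i ≡ j → Comp j x y w → Comp j (δ i α x) (δ i α y) (δ i α w)
    interchange : ∀ i j w x y z a b c d → ¬ i ≡ j →
                  Comp i w x a → Comp i y z b → Comp j w y c → Comp j x z d →
                  ∃ λ e → Comp j a b e × Comp i c d e
    s-cell  : ∀ i x → Cell i x → Cell (suc i) (s i x)
    s̃-cell  : ∀ i x → Cell (suc i) x → Cell i (s̃ i x)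
    s̃s      : ∀ i x → Cell i x → s̃ i (s i x) ≡ x
    ss̃      : ∀ i y → Cell (suc i) y → s i (s̃ i y) ≡ y
    δ-s-same  : ∀ j α x → Cell j x → δ j α (s j x) ≡ s j (δ (suc j) α x)
    δ-s-other : ∀ i j α x → Cell j x → ¬ i ≡ j → ¬ i ≡ suc j →
                δ i α (s j x) ≡ s j (δ i α x)
    s-comp-next  : ∀ i x y w → Cell i x → Cell i y → Comp (suc i) x y w →
                   Comp i (s i x) (s i y) (s i w)
    s-comp-other : ∀ i j x y w → ¬ j ≡ i → ¬ j ≡ suc i → Cell i x → Cell i y →
                   Comp j x y w → Comp j (s i x) (s i y) (s i w)
    s-degenerate : ∀ i x → Cell i x → Cell (suc i) x → s i x ≡ x
    s-comm : ∀ i j x → (suc (suc i) ≤ j) ⊎ (suc (suc j) ≤ i) → Cell i x → Cell j x →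
             s i (s j x) ≡ s j (s i x)
    finite-dim : ∀ x → ∃ λ n → ∀ i → n ≤ i → Cell i x

-- In direction i, the cells of S^i are identities for ∘ᵢ, so ∘ᵢ is trivial on
-- them: x ∘ᵢ y is defined only when x = y, and then equals x.  Since sᵢ sends
-- S^i into S^{i+1}, both (i) and (ii) reduce to statements about identities.
-- For (iii), sᵢ is the identity on S^{i,i+1}, and the remaining cells
-- s_{i+1} x and sᵢ s_{i+1} x are shown to lie in the right S^k through the
-- commutation of faces with the other degeneracies.
module Submission where

open import Defs
open import Data.Nat using (ℕ; suc; _<_)
open import Data.Nat.Properties using (<⇒≢; >⇒≢; n<1+n; m<n⇒m<1+n; 1+n≢n)
open import Data.Product using (_×_; _,_)
open import Relation.Binary.PropositionalEquality
  using (_≡_; _≢_; refl; sym; trans; cong; subst; module ≡-Reasoning)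

module SingleSetCategory {S : Set} {δ⁻ δ⁺ : S → S} {R : Rel3 S}
                         (cat : IsSingleSetCategory δ⁻ δ⁺ R) where
  open IsSingleSetCategory cat

  identity-δ⁺ : ∀ {x} → δ⁻ x ≡ x → δ⁺ x ≡ x
  identity-δ⁺ {x} x-id = subst (λ y → δ⁺ y ≡ y) x-id (defined→ (δ⁻ x) x (x , unitˡ← x))

  identity-comp-self : ∀ {x} → δ⁻ x ≡ x → R x x x
  identity-comp-self {x} x-id = subst (λ y → R x y x) (identity-δ⁺ x-id) (unitʳ← x)

  identity-comp≡ : ∀ {x y w} → δ⁻ x ≡ x → R x y w → x ≡ δ⁻ y
  identity-comp≡ {x} {y} {w} x-id xy≡w = trans (sym (identity-δ⁺ x-id)) (defined→ x y (w , xy≡w))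

  comp-identityˡ : ∀ {x y w} → δ⁻ x ≡ x → R x y w → w ≡ y
  comp-identityˡ {x} {y} {w} x-id xy≡w =
    unitˡ→ y w (subst (λ z → R z y w) (identity-comp≡ x-id xy≡w) xy≡w)

  identities-comp≡ : ∀ {x y w} → δ⁻ x ≡ x → δ⁻ y ≡ y → R x y w → y ≡ x
  identities-comp≡ x-id y-id xy≡w = sym (trans (identity-comp≡ x-id xy≡w) y-id)

i≢1+i : ∀ i → i ≢ suc i
i≢1+i i = <⇒≢ (n<1+n i)

i<2+i : ∀ i → i < suc (suc i)
i<2+i i = m<n⇒m<1+n (n<1+n i)

module _ (C : CubicalOmegaCat) where
  open CubicalOmegaCat C
  module Dir (i : ℕ) = SingleSetCategory (isCat i)

  δ-Cell : ∀ {i α x} → Cell i x → δ i α x ≡ x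
  δ-Cell {α = neg} x∈ = x∈
  δ-Cell {i} {α = pos} x∈ = Dir.identity-δ⁺ i x∈

  s-preserves-Cell : ∀ {i j x} → i ≢ j → i ≢ suc j → Cell j x → Cell i x → Cell i (s j x)
  s-preserves-Cell {i} {j} {x} i≢j i≢1+j x∈j x∈i =
    trans (δ-s-other i j neg x x∈j i≢j i≢1+j) (cong (s j) x∈i)

  δ-suc-s : ∀ j α x → Cell j x → δ (suc j) α (s j x) ≡ s j (δ j α x)
  δ-suc-s j α x x∈ = trans (δ-Cell (s-cell j x x∈)) (cong (s j) (sym (δ-Cell x∈)))

  s-comp-same : ∀ i x y w → Cell i x → Cell i y → Comp i x y w →
                Comp (suc i) (s i x) (s i y) (s i w)
  s-comp-same i x y w x∈ y∈ xy≡w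
    with Dir.identities-comp≡ i x∈ y∈ xy≡w | Dir.comp-identityˡ i x∈ xy≡w
  ... | refl | refl = Dir.identity-comp-self (suc i) (s-cell i x x∈)

  yang-baxter : ∀ i x → Cell i x → Cell (suc i) x →
                s i (s (suc i) (s i x)) ≡ s (suc i) (s i (s (suc i) x))
  yang-baxter i x x∈i x∈1+i = begin
    s i (s (suc i) (s i x))  ≡⟨ cong (λ z → s i (s (suc i) z)) (s-degenerate i x x∈i x∈1+i) ⟩
    s i y                    ≡⟨ sym (s-degenerate (suc i) (s i y) (s-cell i y y∈i) sy∈2+i) ⟩
    s (suc i) (s i y)        ∎
    where
      open ≡-Reasoning
      y = s (suc i) x
      y∈i : Cell i y
      y∈i = s-preserves-Cell (i≢1+i i) (<⇒≢ (i<2+i i)) x∈1+i x∈i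
      sy∈2+i : Cell (suc (suc i)) (s i y)
      sy∈2+i = s-preserves-Cell (>⇒≢ (i<2+i i)) 1+n≢n y∈i (s-cell (suc i) x x∈1+i)

lemma2p2p10 : (C : CubicalOmegaCat) →
    let open CubicalOmegaCat C in
    (∀ j α x → Cell j x → δ (suc j) α (s j x) ≡ s j (δ j α x))
    × (∀ i x y w → Cell i x → Cell i y → Comp i x y w →
         Comp (suc i) (s i x) (s i y) (s i w))
    × (∀ i x → Cell i x → Cell (suc i) x →
         s i (s (suc i) (s i x)) ≡ s (suc i) (s i (s (suc i) x)))
lemma2p2p10 C = δ-suc-s C , s-comp-same C , yang-baxter C
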